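{- Let $q$ be an odd prime power and let $n,k$ be positive integers with $k<n/2$. Then the graph $\Gamma^{\square}(n,k,q)$ defined in the context is vertex-transitive and arc-transitive.
   Context: Let $q$ be an odd prime power and $\lambda$ a nonsquare in $\mathbb{F}_q$. Let $\lambda\mathrm{dot}_n$ denote the quadratic space $(\mathbb{F}_q^n, Q)$ with $Q(\mathbf{x})=x_1^2+\cdots+x_{n-1}^2+\lambda x_n^2$, and let $\perp$ denote orthogonality with respect to the symmetric bilinear form associated with $Q$. A $\mathrm{dot}_k$-subspace is a $k$-dimensional subspace $W\subseteq\mathbb{F}_q^n$ such that $(W,Q|_W)$ is isometrically isomorphic to $(\mathbb{F}_q^k, x_1^2+\cdots+x_k^2)$. The graph $\Gamma^{\square}(n,k,q)$ has as vertex set the set of $\mathrm{dot}_k$-subspaces of $\lambda\mathrm{dot}_n$, with two vertices $x,y$ adjacent if and only if $x\subseteq y^{\perp}$. Arc-transitive means the automorphism group acts transitively on ordered pairs of adjacent vertices. -}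

module Defs where

open import Level using (Level; _⊔_; suc)
open import Data.Nat as ℕ using (ℕ; _^_)
open import Data.Nat.Primality using (Prime)
open import Data.Fin as Fin using (Fin; fromℕ; inject₁)
open import Data.Fin.Properties using () renaming (≡-setoid to Fin-setoid)
open import Data.Product using (Σ; ∃; _×_; _,_; proj₁; proj₂)
open import Relation.Nullary using (¬_)
open import Relation.Binary.PropositionalEquality using (_≡_)
open import Algebra.Bundles using (CommutativeRing)
open import Function.Bundles using (Inverse)

record Field (c ℓ : Level) : Set (Level.suc (c ⊔ ℓ)) where
  field
    commRing : CommutativeRing c ℓ
  open CommutativeRing commRing public
  field
    1≉0     : ¬ (1# ≈ 0#)
    inverse : ∀ x → ¬ (x ≈ 0#) → Σ Carrier λ y → (x * y) ≈ 1#

HasCard : ∀ {c ℓ} → Field c ℓ → ℕ → Set (c ⊔ ℓ)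
HasCard F q = Inverse (Fin-setoid q) (CommutativeRing.setoid (Field.commRing F))

OddPrimePower : ℕ → Set
OddPrimePower q = Σ ℕ λ p → Σ ℕ λ m → Prime p × ¬ (p ≡ 2) × 1 ℕ.≤ m × q ≡ p ^ m

module QuadraticSpace {c ℓ} (F : Field c ℓ) where
  open Field F

  Vec : ℕ → Set c
  Vec n = Fin n → Carrier

  sumF : ∀ n → (Fin n → Carrier) → Carrier
  sumF ℕ.zero    f = 0#
  sumF (ℕ.suc n) f = f Fin.zero + sumF n (λ i → f (Fin.suc i))

  _+ᵥ_ : ∀ {n} → Vec n → Vec n → Vec n
  (u +ᵥ v) i = u i + v i

  _·ᵥ_ : ∀ {n} → Carrier → Vec n → Vec n
  (a ·ᵥ v) i = a * v i

  0ᵥ : ∀ {n} → Vec n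
  0ᵥ i = 0#

  _≈ᵥ_ : ∀ {n} → Vec n → Vec n → Set ℓ
  u ≈ᵥ v = ∀ i → u i ≈ v i

  dotQ : ∀ k → Vec k → Carrier
  dotQ k x = sumF k (λ i → x i * x i)

  weight : ∀ n → Carrier → Vec n
  weight ℕ.zero    lam ()
  weight (ℕ.suc n) lam i with Fin.toℕ i ℕ.≟ n
  ... | Relation.Nullary.yes _ = lam
  ... | Relation.Nullary.no  _ = 1#

  lamQ : ∀ n → Carrier → Vec n → Carrier
  lamQ n lam x = sumF n (λ i → weight n lam i * (x i * x i))

  -- associated symmetric bilinear form B(x,y) = x₁y₁ + ⋯ + x_{n-1}y_{n-1} + λ x_n y_n
  -- (this is ½(Q(x+y)−Q(x)−Q(y)); orthogonality is the same for any nonzero multiple)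
  lamB : ∀ n → Carrier → Vec n → Vec n → Carrier
  lamB n lam x y = sumF n (λ i → weight n lam i * (x i * y i))

  Subset : ℕ → Set (Level.suc (c ⊔ ℓ))
  Subset n = Vec n → Set (c ⊔ ℓ)

  record IsSubspace {n} (W : Subset n) : Set (c ⊔ ℓ) where
    field
      resp  : ∀ {u v} → u ≈ᵥ v → W u → W v
      zero∈ : W 0ᵥ
      +∈    : ∀ {u v} → W u → W v → W (u +ᵥ v)
      ·∈    : ∀ a {v} → W v → W (a ·ᵥ v)

  record IsLinear {m n} (f : Vec m → Vec n) : Set (c ⊔ ℓ) where
    field
      cong  : ∀ {u v} → u ≈ᵥ v → f u ≈ᵥ f v
      add   : ∀ u v → f (u +ᵥ v) ≈ᵥ (f u +ᵥ f v)
      scale : ∀ a v → f (a ·ᵥ v) ≈ᵥ (a ·ᵥ f v)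

  record IsometricToDot (n k : ℕ) (lam : Carrier) (W : Subset n) : Set (c ⊔ ℓ) where
    field
      φ        : Vec k → Vec n
      linear   : IsLinear φ
      into     : ∀ x → W (φ x)
      injective : ∀ x y → φ x ≈ᵥ φ y → x ≈ᵥ y
      onto     : ∀ w → W w → Σ (Vec k) λ x → φ x ≈ᵥ w
      isometry : ∀ x → lamQ n lam (φ x) ≈ dotQ k x

  record DotSubspace (n k : ℕ) (lam : Carrier) : Set (Level.suc (c ⊔ ℓ)) where
    field
      W        : Subset n
      subspace : IsSubspace W
      iso      : IsometricToDot n k lam W

  module Γ (n k : ℕ) (lam : Carrier) where
    V : Set (Level.suc (c ⊔ ℓ))
    V = DotSubspace n k lam

    -- equality of vertices = equality of subspaces as sets
    _≈V_ : V → V → Set (c ⊔ ℓ)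
    x ≈V y = ∀ v → (DotSubspace.W x v → DotSubspace.W y v) × (DotSubspace.W y v → DotSubspace.W x v)

    Adj : V → V → Set (c ⊔ ℓ)
    Adj x y = ∀ u v → DotSubspace.W x u → DotSubspace.W y v → lamB n lam u v ≈ 0#

    record Automorphism : Set (Level.suc (c ⊔ ℓ)) where
      field
        to       : V → V
        from     : V → V
        to-cong  : ∀ {x y} → x ≈V y → to x ≈V to y
        from-cong : ∀ {x y} → x ≈V y → from x ≈V from y
        to-from  : ∀ x → to (from x) ≈V x
        from-to  : ∀ x → from (to x) ≈V x
        adj      : ∀ x y → (Adj x y → Adj (to x) (to y)) × (Adj (to x) (to y) → Adj x y)

    VertexTransitive : Set (Level.suc (c ⊔ ℓ))
    VertexTransitive = ∀ x y → Σ Automorphism λ σ → Automorphism.to σ x ≈V y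

    ArcTransitive : Set (Level.suc (c ⊔ ℓ))
    ArcTransitive = ∀ x y x' y' → Adj x y → Adj x' y' →
      Σ Automorphism λ σ → (Automorphism.to σ x ≈V x') × (Automorphism.to σ y ≈V y')

module Submission where

-- Every isometry g of λdot_n (a linear automorphism preserving the bilinear
-- form) maps dot_k-subspaces to dot_k-subspaces and preserves orthogonality,
-- so W ↦ g(W) is a graph automorphism.  A vertex x comes with an isometry
-- φₓ : dot_k → Wₓ, so φₓ(δ₁), …, φₓ(δ_k) is an orthonormal frame of Wₓ (by
-- polarisation, as 2 ≠ 0); for an edge x ~ y the frames of x and y together
-- form an orthonormal 2k-frame.  Witt's extension theorem for orthonormal
-- frames, proved here by composing reflections, relates any two orthonormal
-- frames of the same size by an isometry, which then maps x onto y (resp. the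
-- arc (x,y) onto (x',y')).  The field hypotheses enter only through two
-- consequences: a finite field has decidable equality, and the existence of a
-- nonsquare forces 2 ≠ 0 (in characteristic 2 squaring is injective, hence
-- bijective on a finite field).

open import Defs
open import Data.Nat using (ℕ; _<_)
open import Data.Product using (_×_)
open import Relation.Nullary using (¬_)

open import Level using (_⊔_)
open import Data.Nat as ℕ using (zero; suc)
import Data.Nat.Properties as ℕₚ
open import Data.Integer as ℤ using (ℤ; +_; -[1+_])
import Data.Integer.Properties as ℤₚ
open import Data.Sign as Sign using (Sign)
open import Data.Fin as Fin using (Fin; zero; suc; _↑ˡ_; _↑ʳ_; splitAt)
import Data.Fin.Properties as Finₚ
open import Data.Product using (Σ; _,_; proj₁; proj₂)
open import Data.Sum using (_⊎_; inj₁; inj₂; [_,_]′)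
open import Data.Maybe using (Maybe; just; nothing)
open import Relation.Nullary using (Dec; yes; no)
open import Relation.Binary.PropositionalEquality as ≡ using (_≡_; _≢_; ≢-sym)
open import Function.Definitions using (Injective)
open import Function.Bundles using (Inverse)
open import Algebra.Bundles using (CommutativeRing)

-- The ring solver of Algebra.Solver.Ring normalises polynomials whose
-- constants live in a coefficient ring mapped homomorphically into the
-- target ring.
module IntegerCoefficients {c ℓ} (R : CommutativeRing c ℓ) where
  open CommutativeRing R
  open import Algebra.Properties.Semiring.Mult.TCOptimised semiring using (1+×; ×-homo-+; ×1-homo-*)
    renaming (_×_ to _×′_)
  open import Algebra.Properties.Ring ring using (-‿distribˡ-*; -‿distribʳ-*)
  open import Algebra.Properties.AbelianGroup +-abelianGroup using (⁻¹-∙-comm; ⁻¹-involutive; ε⁻¹≈ε)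
  open import Algebra.Solver.Ring.AlmostCommutativeRing
    using (fromCommutativeRing; _-Raw-AlmostCommutative⟶_)
  open import Relation.Binary.Reasoning.Setoid setoid

  ⟦_⟧ : ℤ → Carrier
  ⟦ + n ⟧      = n ×′ 1#
  ⟦ -[1+ n ] ⟧ = - (suc n ×′ 1#)

  -‿homo : ∀ i → ⟦ ℤ.- i ⟧ ≈ - ⟦ i ⟧
  -‿homo (+ zero)  = sym ε⁻¹≈ε
  -‿homo (+ suc n) = refl
  -‿homo -[1+ n ]  = sym (⁻¹-involutive _)

  [x+a]-[x+b]≈a-b : ∀ x a b → (x + a) - (x + b) ≈ a - b
  [x+a]-[x+b]≈a-b x a b = begin
    (x + a) - (x + b)        ≈⟨ +-congˡ (⁻¹-∙-comm x b) ⟨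
    (x + a) + (- x - b)      ≈⟨ +-congʳ (+-comm x a) ⟩
    (a + x) + (- x - b)      ≈⟨ +-assoc a x _ ⟩
    a + (x + (- x - b))      ≈⟨ +-congˡ (+-assoc x (- x) _) ⟨
    a + ((x - x) - b)        ≈⟨ +-congˡ (+-congʳ (-‿inverseʳ x)) ⟩
    a + (0# - b)             ≈⟨ +-congˡ (+-identityˡ _) ⟩
    a - b                    ∎

  ⊖-homo : ∀ m n → ⟦ m ℤ.⊖ n ⟧ ≈ m ×′ 1# - n ×′ 1#
  ⊖-homo zero    zero    = sym (trans (+-congˡ ε⁻¹≈ε) (+-identityʳ _))
  ⊖-homo zero    (suc n) = sym (+-identityˡ _)
  ⊖-homo (suc m) zero    = sym (trans (+-congˡ ε⁻¹≈ε) (+-identityʳ _))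
  ⊖-homo (suc m) (suc n) rewrite ℤₚ.[1+m]⊖[1+n]≡m⊖n m n = begin
    ⟦ m ℤ.⊖ n ⟧                      ≈⟨ ⊖-homo m n ⟩
    m ×′ 1# - n ×′ 1#                ≈⟨ [x+a]-[x+b]≈a-b 1# (m ×′ 1#) (n ×′ 1#) ⟨
    (1# + m ×′ 1#) - (1# + n ×′ 1#)  ≈⟨ +-cong (1+× m 1#) (-‿cong (1+× n 1#)) ⟨
    suc m ×′ 1# - suc n ×′ 1#        ∎

  +-homo : ∀ i j → ⟦ i ℤ.+ j ⟧ ≈ ⟦ i ⟧ + ⟦ j ⟧
  +-homo (+ m)    (+ n)    = ×-homo-+ 1# m n
  +-homo (+ m)    -[1+ n ] = ⊖-homo m (suc n)
  +-homo -[1+ m ] (+ n)    = trans (⊖-homo n (suc m)) (+-comm _ _)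
  +-homo -[1+ m ] -[1+ n ] = begin
    - (suc (suc (m ℕ.+ n)) ×′ 1#)  ≡⟨ ≡.cong (λ k → - (suc k ×′ 1#)) (ℕₚ.+-suc m n) ⟨
    - ((suc m ℕ.+ suc n) ×′ 1#)    ≈⟨ -‿cong (×-homo-+ 1# (suc m) (suc n)) ⟩
    - (suc m ×′ 1# + suc n ×′ 1#)  ≈⟨ ⁻¹-∙-comm _ _ ⟨
    - (suc m ×′ 1#) - suc n ×′ 1#  ∎

  -- multiplication is handled through the sign/absolute-value decomposition
  signed : Sign → Carrier → Carrier
  signed Sign.+ x = x
  signed Sign.- x = - x

  signed-cong : ∀ s {x y} → x ≈ y → signed s x ≈ signed s y
  signed-cong Sign.+ e = e
  signed-cong Sign.- e = -‿cong e

  ◃-homo : ∀ s n → ⟦ s ℤ.◃ n ⟧ ≈ signed s (n ×′ 1#)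
  ◃-homo Sign.+ zero    = refl
  ◃-homo Sign.- zero    = sym ε⁻¹≈ε
  ◃-homo Sign.+ (suc n) = refl
  ◃-homo Sign.- (suc n) = refl

  sign-abs : ∀ i → ⟦ i ⟧ ≈ signed (ℤ.sign i) (ℤ.∣ i ∣ ×′ 1#)
  sign-abs (+ n)    = refl
  sign-abs -[1+ n ] = refl

  signed-* : ∀ s t x y → signed (s Sign.* t) (x * y) ≈ signed s x * signed t y
  signed-* Sign.+ Sign.+ x y = refl
  signed-* Sign.+ Sign.- x y = -‿distribʳ-* x y
  signed-* Sign.- Sign.+ x y = -‿distribˡ-* x y
  signed-* Sign.- Sign.- x y = begin
    x * y          ≈⟨ ⁻¹-involutive _ ⟨
    - - (x * y)    ≈⟨ -‿cong (-‿distribʳ-* x y) ⟩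
    - (x * - y)    ≈⟨ -‿distribˡ-* x (- y) ⟩
    - x * - y      ∎

  *-homo : ∀ i j → ⟦ i ℤ.* j ⟧ ≈ ⟦ i ⟧ * ⟦ j ⟧
  *-homo i j = begin
    ⟦ (s Sign.* t) ℤ.◃ (∣i∣ ℕ.* ∣j∣) ⟧          ≈⟨ ◃-homo (s Sign.* t) (∣i∣ ℕ.* ∣j∣) ⟩
    signed (s Sign.* t) ((∣i∣ ℕ.* ∣j∣) ×′ 1#)    ≈⟨ signed-cong (s Sign.* t) (×1-homo-* ∣i∣ ∣j∣) ⟩
    signed (s Sign.* t) (∣i∣ ×′ 1# * ∣j∣ ×′ 1#)  ≈⟨ signed-* s t _ _ ⟩
    signed s (∣i∣ ×′ 1#) * signed t (∣j∣ ×′ 1#)  ≈⟨ *-cong (sign-abs i) (sign-abs j) ⟨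
    ⟦ i ⟧ * ⟦ j ⟧                                ∎
    where
    s t : Sign
    s = ℤ.sign i
    t = ℤ.sign j
    ∣i∣ ∣j∣ : ℕ
    ∣i∣ = ℤ.∣ i ∣
    ∣j∣ = ℤ.∣ j ∣

  homomorphism : ℤ.+-*-rawRing -Raw-AlmostCommutative⟶ fromCommutativeRing R
  homomorphism = record
    { ⟦_⟧ = ⟦_⟧ ; +-homo = +-homo ; *-homo = *-homo ; -‿homo = -‿homo
    ; 0-homo = refl ; 1-homo = refl }

  -- equal integers have equal interpretations (all the solver needs)
  coefficients? : ∀ a b → Maybe (⟦ a ⟧ ≈ ⟦ b ⟧)
  coefficients? a b with a ℤ.≟ b
  ... | yes ≡.refl = just refl
  ... | no _       = nothing

  open import Algebra.Solver.Ring ℤ.+-*-rawRing (fromCommutativeRing R) homomorphism coefficients? public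
    using (solve; _:=_; _:+_; _:*_; :-_; con)

module FieldArithmetic {c ℓ} (F : Field c ℓ) where
  open Field F
  open IntegerCoefficients commRing
  open import Algebra.Properties.Group +-group using (x∙y⁻¹≈ε⇒x≈y)
  open import Relation.Binary.Reasoning.Setoid setoid

  2# : Carrier
  2# = 1# + 1#

  nonzero-cancel : ∀ {x y} → ¬ (x ≈ 0#) → x * y ≈ 0# → y ≈ 0#
  nonzero-cancel {x} {y} x≉0 xy≈0 = begin
    y              ≈⟨ *-identityˡ y ⟨
    1# * y         ≈⟨ *-congʳ x⁻¹x≈1 ⟨
    (x⁻¹ * x) * y  ≈⟨ *-assoc _ _ _ ⟩
    x⁻¹ * (x * y)  ≈⟨ *-congˡ xy≈0 ⟩
    x⁻¹ * 0#       ≈⟨ zeroʳ _ ⟩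
    0#             ∎
    where
    x⁻¹ : Carrier
    x⁻¹ = proj₁ (inverse x x≉0)
    x⁻¹x≈1 : x⁻¹ * x ≈ 1#
    x⁻¹x≈1 = trans (*-comm _ _) (proj₂ (inverse x x≉0))

  [-1]²≈1 : - 1# * - 1# ≈ 1#
  [-1]²≈1 = solve 0 ((:- con (+ 1)) :* (:- con (+ 1)) := con (+ 1)) refl

  product-nonzero : ∀ {x y} → ¬ (x ≈ 0#) → ¬ (y ≈ 0#) → ¬ (x * y ≈ 0#)
  product-nonzero x≉0 y≉0 xy≈0 = y≉0 (nonzero-cancel x≉0 xy≈0)

  halve : ¬ (2# ≈ 0#) → ∀ {x y} → 2# * x ≈ 2# * y → x ≈ y
  halve 2≉0 {x} {y} 2x≈2y = x∙y⁻¹≈ε⇒x≈y x y (nonzero-cancel 2≉0 (begin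
    2# * (x - y)       ≈⟨ solve 2 (λ x y → con (+ 2) :* (x :+ :- y) := con (+ 2) :* x :+ :- (con (+ 2) :* y)) refl x y ⟩
    2# * x - 2# * y    ≈⟨ +-congʳ 2x≈2y ⟩
    2# * y - 2# * y    ≈⟨ -‿inverseʳ _ ⟩
    0#                 ∎))

  -- in characteristic 2 (with decidable equality) squaring is injective:
  -- x² = y² gives (x + y)² = 0, so x + y = 0, and x - y = x + y - 2y = 0
  square-injective : (∀ x y → Dec (x ≈ y)) → 2# ≈ 0# → ∀ {x y} → x * x ≈ y * y → x ≈ y
  square-injective _≟_ 2≈0 {x} {y} x²≈y² = x∙y⁻¹≈ε⇒x≈y x y (begin
    x - y                    ≈⟨ solve 2 (λ x y → x :+ :- y := (x :+ y) :+ :- (con (+ 2) :* y)) refl x y ⟩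
    (x + y) - 2# * y         ≈⟨ +-cong x+y≈0 (-‿cong (trans (*-congʳ 2≈0) (zeroˡ y))) ⟩
    0# - 0#                  ≈⟨ -‿inverseʳ 0# ⟩
    0#                       ∎)
    where
    [x+y]²≈0 : (x + y) * (x + y) ≈ 0#
    [x+y]²≈0 = begin
      (x + y) * (x + y)
        ≈⟨ solve 2 (λ x y → (x :+ y) :* (x :+ y) := (x :* x :+ :- (y :* y)) :+ con (+ 2) :* (y :* y :+ x :* y)) refl x y ⟩
      (x * x - y * y) + 2# * (y * y + x * y)
        ≈⟨ +-cong (trans (+-congʳ x²≈y²) (-‿inverseʳ _)) (trans (*-congʳ 2≈0) (zeroˡ _)) ⟩
      0# + 0#
        ≈⟨ +-identityˡ 0# ⟩
      0# ∎
    x+y≈0 : x + y ≈ 0#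
    x+y≈0 with (x + y) ≟ 0#
    ... | yes x+y≈0 = x+y≈0
    ... | no  x+y≉0 = nonzero-cancel x+y≉0 [x+y]²≈0

module Geometry {c ℓ} (F : Field c ℓ)
                (_≟_ : ∀ x y → Dec (Field._≈_ F x y))
                (2≉0 : ¬ Field._≈_ F (FieldArithmetic.2# F) (Field.0# F)) where
  open Field F hiding (zero)
  open FieldArithmetic F
  open IntegerCoefficients commRing
  open QuadraticSpace F
  open import Algebra.Properties.Group +-group using (∙-cancelˡ; ∙-cancelʳ)
  open import Relation.Binary.Reasoning.Setoid setoid

  sum-cong : ∀ m {f g : Fin m → Carrier} → (∀ i → f i ≈ g i) → sumF m f ≈ sumF m g
  sum-cong zero    f≈g = refl
  sum-cong (suc m) f≈g = +-cong (f≈g zero) (sum-cong m (λ i → f≈g (suc i)))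

  sum-+ : ∀ m (f g : Fin m → Carrier) → sumF m (λ i → f i + g i) ≈ sumF m f + sumF m g
  sum-+ zero    f g = sym (+-identityˡ 0#)
  sum-+ (suc m) f g = trans (+-congˡ (sum-+ m _ _))
    (solve 4 (λ a b c d → (a :+ b) :+ (c :+ d) := (a :+ c) :+ (b :+ d)) refl _ _ _ _)

  sum-* : ∀ m a (f : Fin m → Carrier) → sumF m (λ i → a * f i) ≈ a * sumF m f
  sum-* zero    a f = sym (zeroʳ a)
  sum-* (suc m) a f = trans (+-congˡ (sum-* m a _)) (sym (distribˡ _ _ _))

  sum-0 : ∀ m (f : Fin m → Carrier) → (∀ i → f i ≈ 0#) → sumF m f ≈ 0#
  sum-0 zero    f f≈0 = refl
  sum-0 (suc m) f f≈0 = trans (+-cong (f≈0 zero) (sum-0 m _ (λ i → f≈0 (suc i)))) (+-identityˡ 0#)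

  δ : ∀ {m} → Fin m → Vec m
  δ zero    zero    = 1#
  δ zero    (suc _) = 0#
  δ (suc _) zero    = 0#
  δ (suc i) (suc j) = δ i j

  δ-sym : ∀ {m} (i j : Fin m) → δ i j ≡ δ j i
  δ-sym zero    zero    = ≡.refl
  δ-sym zero    (suc j) = ≡.refl
  δ-sym (suc i) zero    = ≡.refl
  δ-sym (suc i) (suc j) = δ-sym i j

  sum-δ : ∀ m (j : Fin m) (y : Vec m) → sumF m (λ i → δ j i * y i) ≈ y j
  sum-δ (suc m) zero    y = trans (+-cong (*-identityˡ _) (sum-0 m _ (λ i → zeroˡ _))) (+-identityʳ _)
  sum-δ (suc m) (suc j) y = trans (+-cong (zeroˡ _) (sum-δ m j (λ i → y (suc i)))) (+-identityˡ _)

  δ-↑ˡ↑ˡ : ∀ {m₁} m₂ (i j : Fin m₁) → δ (i ↑ˡ m₂) (j ↑ˡ m₂) ≡ δ i j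
  δ-↑ˡ↑ˡ m₂ zero    zero    = ≡.refl
  δ-↑ˡ↑ˡ m₂ zero    (suc j) = ≡.refl
  δ-↑ˡ↑ˡ m₂ (suc i) zero    = ≡.refl
  δ-↑ˡ↑ˡ m₂ (suc i) (suc j) = δ-↑ˡ↑ˡ m₂ i j

  δ-↑ʳ↑ʳ : ∀ m₁ {m₂} (i j : Fin m₂) → δ (m₁ ↑ʳ i) (m₁ ↑ʳ j) ≡ δ i j
  δ-↑ʳ↑ʳ zero     i j = ≡.refl
  δ-↑ʳ↑ʳ (suc m₁) i j = δ-↑ʳ↑ʳ m₁ i j

  δ-↑ˡ↑ʳ : ∀ {m₁} m₂ (i : Fin m₁) (j : Fin m₂) → δ (i ↑ˡ m₂) (m₁ ↑ʳ j) ≡ 0#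
  δ-↑ˡ↑ʳ m₂ zero    j = ≡.refl
  δ-↑ˡ↑ʳ m₂ (suc i) j = δ-↑ˡ↑ʳ m₂ i j

  ≈ᵥ-refl : ∀ {m} {u : Vec m} → u ≈ᵥ u
  ≈ᵥ-refl i = refl

  ≈ᵥ-sym : ∀ {m} {u v : Vec m} → u ≈ᵥ v → v ≈ᵥ u
  ≈ᵥ-sym u≈v i = sym (u≈v i)

  ≈ᵥ-trans : ∀ {m} {u v w : Vec m} → u ≈ᵥ v → v ≈ᵥ w → u ≈ᵥ w
  ≈ᵥ-trans u≈v v≈w i = trans (u≈v i) (v≈w i)

  ≡⇒≈ᵥ : ∀ {m} {u v : Vec m} → u ≡ v → u ≈ᵥ v
  ≡⇒≈ᵥ ≡.refl = ≈ᵥ-refl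

  ∘-linear : ∀ {a b d} {f : Vec a → Vec b} {g : Vec b → Vec d} →
             IsLinear f → IsLinear g → IsLinear (λ v → g (f v))
  ∘-linear f-lin g-lin = record
    { cong  = λ u≈v → G.cong (Fₗ.cong u≈v)
    ; add   = λ u v → ≈ᵥ-trans (G.cong (Fₗ.add u v)) (G.add _ _)
    ; scale = λ a v → ≈ᵥ-trans (G.cong (Fₗ.scale a v)) (G.scale _ _) }
    where
    module Fₗ = IsLinear f-lin
    module G = IsLinear g-lin

  linear-0 : ∀ {a b} {f : Vec a → Vec b} → IsLinear f → f 0ᵥ ≈ᵥ 0ᵥ
  linear-0 f-lin = ≈ᵥ-trans (IsLinear.cong f-lin (λ i → sym (zeroˡ 0#)))
                            (≈ᵥ-trans (IsLinear.scale f-lin 0# 0ᵥ) (λ i → zeroˡ _))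

  vsum : ∀ {d} m → (Fin m → Vec d) → Vec d
  vsum zero    v = 0ᵥ
  vsum (suc m) v = v zero +ᵥ vsum m (λ i → v (suc i))

  vsum-cong : ∀ {d} m {v w : Fin m → Vec d} → (∀ i → v i ≈ᵥ w i) → vsum m v ≈ᵥ vsum m w
  vsum-cong zero    v≈w = ≈ᵥ-refl
  vsum-cong (suc m) v≈w j = +-cong (v≈w zero j) (vsum-cong m (λ i → v≈w (suc i)) j)

  linear-vsum : ∀ {a b} {f : Vec a → Vec b} → IsLinear f →
                ∀ m v → f (vsum m v) ≈ᵥ vsum m (λ i → f (v i))
  linear-vsum f-lin zero    v = linear-0 f-lin
  linear-vsum f-lin (suc m) v =
    ≈ᵥ-trans (IsLinear.add f-lin _ _) (λ j → +-congˡ (linear-vsum f-lin m _ j))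

  vsum-at : ∀ {d} m (v : Fin m → Vec d) j → vsum m v j ≈ sumF m (λ i → v i j)
  vsum-at zero    v j = refl
  vsum-at (suc m) v j = +-congˡ (vsum-at m _ j)

  basis-expansion : ∀ m (x : Vec m) → x ≈ᵥ vsum m (λ i → x i ·ᵥ δ i)
  basis-expansion m x j = sym (begin
    vsum m (λ i → x i ·ᵥ δ i) j   ≈⟨ vsum-at m _ j ⟩
    sumF m (λ i → x i * δ i j)    ≈⟨ sum-cong m (λ i → trans (*-comm _ _) (reflexive (≡.cong (_* x i) (δ-sym i j)))) ⟩
    sumF m (λ i → δ j i * x i)    ≈⟨ sum-δ m j x ⟩
    x j                           ∎)

  linear-on-basis : ∀ {m d} {f : Vec m → Vec d} → IsLinear f →
                    ∀ x → f x ≈ᵥ vsum m (λ i → x i ·ᵥ f (δ i))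
  linear-on-basis {m} f-lin x =
    ≈ᵥ-trans (IsLinear.cong f-lin (basis-expansion m x))
    (≈ᵥ-trans (linear-vsum f-lin m _) (vsum-cong m (λ i → IsLinear.scale f-lin (x i) (δ i))))

  linear-extensionality : ∀ {m d} {f g : Vec m → Vec d} → IsLinear f → IsLinear g →
                          (∀ i → f (δ i) ≈ᵥ g (δ i)) → ∀ x → f x ≈ᵥ g x
  linear-extensionality {m} f-lin g-lin f≈g x =
    ≈ᵥ-trans (linear-on-basis f-lin x)
    (≈ᵥ-trans (vsum-cong m (λ i j → *-congˡ (f≈g i j))) (≈ᵥ-sym (linear-on-basis g-lin x)))

  record IsSymBilinear {n} (B : Vec n → Vec n → Carrier) : Set (c ⊔ ℓ) where
    field
      B-cong : ∀ {x x' y y'} → x ≈ᵥ x' → y ≈ᵥ y' → B x y ≈ B x' y'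
      B-sym  : ∀ x y → B x y ≈ B y x
      B-+ˡ   : ∀ x x' y → B (x +ᵥ x') y ≈ B x y + B x' y
      B-·ˡ   : ∀ a x y → B (a ·ᵥ x) y ≈ a * B x y

    B-+ʳ : ∀ x y y' → B x (y +ᵥ y') ≈ B x y + B x y'
    B-+ʳ x y y' = trans (B-sym x _) (trans (B-+ˡ y y' x) (+-cong (B-sym y x) (B-sym y' x)))

    B-·ʳ : ∀ a x y → B x (a ·ᵥ y) ≈ a * B x y
    B-·ʳ a x y = trans (B-sym x _) (trans (B-·ˡ a y x) (*-congˡ (B-sym y x)))

    B-combʳ : ∀ x y a z → B x (y +ᵥ (a ·ᵥ z)) ≈ B x y + a * B x z
    B-combʳ x y a z = trans (B-+ʳ x y _) (+-congˡ (B-·ʳ a x z))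

    B-comb : ∀ x α z y β w → B (x +ᵥ (α ·ᵥ z)) (y +ᵥ (β ·ᵥ w)) ≈
             B x y + β * B x w + α * B z y + α * (β * B z w)
    B-comb x α z y β w = begin
      B (x +ᵥ (α ·ᵥ z)) (y +ᵥ (β ·ᵥ w))
        ≈⟨ B-+ˡ x _ _ ⟩
      B x (y +ᵥ (β ·ᵥ w)) + B (α ·ᵥ z) (y +ᵥ (β ·ᵥ w))
        ≈⟨ +-cong (B-combʳ x y β w) (trans (B-·ˡ α z _) (*-congˡ (B-combʳ z y β w))) ⟩
      (B x y + β * B x w) + α * (B z y + β * B z w)
        ≈⟨ solve 6 (λ p q r s α β → (p :+ β :* q) :+ α :* (r :+ β :* s) := p :+ β :* q :+ α :* r :+ α :* (β :* s)) refl _ _ _ _ α β ⟩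
      B x y + β * B x w + α * B z y + α * (β * B z w) ∎

    polarisation : ∀ x y → B (x +ᵥ y) (x +ᵥ y) ≈ B x x + 2# * B x y + B y y
    polarisation x y = begin
      B (x +ᵥ y) (x +ᵥ y)                        ≈⟨ B-+ˡ x y _ ⟩
      B x (x +ᵥ y) + B y (x +ᵥ y)                ≈⟨ +-cong (B-+ʳ x x y) (B-+ʳ y x y) ⟩
      (B x x + B x y) + (B y x + B y y)          ≈⟨ +-congˡ (+-congʳ (B-sym y x)) ⟩
      (B x x + B x y) + (B x y + B y y)          ≈⟨ solve 3 (λ p q r → (p :+ q) :+ (q :+ r) := p :+ con (+ 2) :* q :+ r) refl _ _ _ ⟩
      B x x + 2# * B x y + B y y                 ∎

  diagonal : ∀ {m} → Vec m → Vec m → Vec m → Carrier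
  diagonal {m} w x y = sumF m (λ i → w i * (x i * y i))

  diagonal-isSymBilinear : ∀ {m} (w : Vec m) → IsSymBilinear (diagonal w)
  diagonal-isSymBilinear {m} w = record
    { B-cong = λ x≈x' y≈y' → sum-cong m (λ i → *-congˡ (*-cong (x≈x' i) (y≈y' i)))
    ; B-sym  = λ x y → sum-cong m (λ i → *-congˡ (*-comm _ _))
    ; B-+ˡ   = λ x x' y → trans (sum-cong m (λ i →
        solve 4 (λ w x x' y → w :* ((x :+ x') :* y) := w :* (x :* y) :+ w :* (x' :* y)) refl (w i) (x i) (x' i) (y i)))
        (sum-+ m _ _)
    ; B-·ˡ   = λ a x y → trans (sum-cong m (λ i →
        solve 4 (λ w a x y → w :* ((a :* x) :* y) := a :* (w :* (x :* y))) refl (w i) a (x i) (y i)))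
        (sum-* m a _) }

  dot-δ : ∀ {m} (i j : Fin m) → diagonal (λ _ → 1#) (δ i) (δ j) ≈ δ i j
  dot-δ {m} i j = begin
    sumF m (λ l → 1# * (δ i l * δ j l))  ≈⟨ sum-cong m (λ l → *-identityˡ _) ⟩
    sumF m (λ l → δ i l * δ j l)         ≈⟨ sum-δ m i (δ j) ⟩
    δ j i                                ≡⟨ δ-sym j i ⟩
    δ i j                                ∎

  polarisation-preserves : ∀ {m n} {B₁ : Vec m → Vec m → Carrier} {B₂ : Vec n → Vec n → Carrier} →
    IsSymBilinear B₁ → IsSymBilinear B₂ → ∀ {f : Vec m → Vec n} → IsLinear f →
    (∀ c → B₂ (f c) (f c) ≈ B₁ c c) → ∀ c d → B₂ (f c) (f d) ≈ B₁ c d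
  polarisation-preserves {B₁ = B₁} {B₂} bil₁ bil₂ {f} f-lin f-isometric c d =
    halve 2≉0 (∙-cancelˡ (B₁ c c) _ _ (∙-cancelʳ (B₁ d d) _ _ (begin
      B₁ c c + 2# * B₂ (f c) (f d) + B₁ d d
        ≈⟨ +-cong (+-congʳ (f-isometric c)) (f-isometric d) ⟨
      B₂ (f c) (f c) + 2# * B₂ (f c) (f d) + B₂ (f d) (f d)
        ≈⟨ S₂.polarisation (f c) (f d) ⟨
      B₂ (f c +ᵥ f d) (f c +ᵥ f d)
        ≈⟨ S₂.B-cong (≈ᵥ-sym (IsLinear.add f-lin c d)) (≈ᵥ-sym (IsLinear.add f-lin c d)) ⟩
      B₂ (f (c +ᵥ d)) (f (c +ᵥ d))
        ≈⟨ f-isometric (c +ᵥ d) ⟩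
      B₁ (c +ᵥ d) (c +ᵥ d)
        ≈⟨ S₁.polarisation c d ⟩
      B₁ c c + 2# * B₁ c d + B₁ d d ∎)))
    where
    module S₁ = IsSymBilinear bil₁
    module S₂ = IsSymBilinear bil₂

  module Isometries {n} {B : Vec n → Vec n → Carrier} (bilinear : IsSymBilinear B) where
    open IsSymBilinear bilinear

    Q : Vec n → Carrier
    Q x = B x x

    record Isometry : Set (c ⊔ ℓ) where
      field
        to from     : Vec n → Vec n
        to-from     : ∀ v → to (from v) ≈ᵥ v
        from-to     : ∀ v → from (to v) ≈ᵥ v
        to-linear   : IsLinear to
        from-linear : IsLinear from
        preserves   : ∀ u v → B (to u) (to v) ≈ B u v

      from-preserves : ∀ u v → B (from u) (from v) ≈ B u v
      from-preserves u v = trans (sym (preserves _ _)) (B-cong (to-from u) (to-from v))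

    open Isometry

    identity : Isometry
    identity = record
      { to = λ v → v ; from = λ v → v ; to-from = λ v → ≈ᵥ-refl ; from-to = λ v → ≈ᵥ-refl
      ; to-linear = id-linear ; from-linear = id-linear ; preserves = λ u v → refl }
      where
      id-linear : IsLinear (λ v → v)
      id-linear = record { cong = λ u≈v → u≈v ; add = λ u v → ≈ᵥ-refl ; scale = λ a v → ≈ᵥ-refl }

    -- τ ∘ᵢ σ : first σ, then τ
    _∘ᵢ_ : Isometry → Isometry → Isometry
    τ ∘ᵢ σ = record
      { to          = λ v → to τ (to σ v)
      ; from        = λ v → from σ (from τ v)
      ; to-from     = λ v → ≈ᵥ-trans (IsLinear.cong (to-linear τ) (to-from σ (from τ v))) (to-from τ v)
      ; from-to     = λ v → ≈ᵥ-trans (IsLinear.cong (from-linear σ) (from-to τ (to σ v))) (from-to σ v)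
      ; to-linear   = ∘-linear (to-linear σ) (to-linear τ)
      ; from-linear = ∘-linear (from-linear τ) (from-linear σ)
      ; preserves   = λ u v → trans (preserves τ _ _) (preserves σ u v) }

    inverse-isometry : Isometry → Isometry
    inverse-isometry σ = record
      { to = from σ ; from = to σ ; to-from = from-to σ ; from-to = to-from σ
      ; to-linear = from-linear σ ; from-linear = to-linear σ ; preserves = from-preserves σ }

    module Reflection (w : Vec n) (Qw≉0 : ¬ (Q w ≈ 0#)) where
      Qw⁻¹ : Carrier
      Qw⁻¹ = proj₁ (inverse (Q w) Qw≉0)

      Qw⁻¹Qw≈1 : Qw⁻¹ * Q w ≈ 1#
      Qw⁻¹Qw≈1 = trans (*-comm _ _) (proj₂ (inverse (Q w) Qw≉0))

      t : Vec n → Carrier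
      t u = 2# * (Qw⁻¹ * B u w)

      s : Vec n → Vec n
      s u = u +ᵥ ((- t u) ·ᵥ w)

      t-cong : ∀ {u v} → u ≈ᵥ v → t u ≈ t v
      t-cong u≈v = *-congˡ (*-congˡ (B-cong u≈v ≈ᵥ-refl))

      t-+ : ∀ u v → t (u +ᵥ v) ≈ t u + t v
      t-+ u v = trans (*-congˡ (*-congˡ (B-+ˡ u v w)))
        (solve 3 (λ c p r → con (+ 2) :* (c :* (p :+ r)) := con (+ 2) :* (c :* p) :+ con (+ 2) :* (c :* r)) refl _ _ _)

      t-· : ∀ a u → t (a ·ᵥ u) ≈ a * t u
      t-· a u = trans (*-congˡ (*-congˡ (B-·ˡ a u w)))
        (solve 3 (λ c a p → con (+ 2) :* (c :* (a :* p)) := a :* (con (+ 2) :* (c :* p))) refl _ _ _)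

      t-w : t w ≈ 2#
      t-w = trans (*-congˡ Qw⁻¹Qw≈1) (*-identityʳ 2#)

      s-linear : IsLinear s
      s-linear = record
        { cong  = λ u≈v i → +-cong (u≈v i) (*-congʳ (-‿cong (t-cong u≈v)))
        ; add   = λ u v i → trans (+-congˡ (*-congʳ (-‿cong (t-+ u v))))
            (solve 5 (λ a b p r z → (a :+ b) :+ (:- (p :+ r)) :* z := (a :+ (:- p) :* z) :+ (b :+ (:- r) :* z)) refl _ _ _ _ _)
        ; scale = λ a u i → trans (+-congˡ (*-congʳ (-‿cong (t-· a u))))
            (solve 4 (λ a b p z → a :* b :+ (:- (a :* p)) :* z := a :* (b :+ (:- p) :* z)) refl _ _ _ _) }

      s-preserves : ∀ u v → B (s u) (s v) ≈ B u v
      s-preserves u v = begin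
        B (s u) (s v)
          ≈⟨ B-comb u (- t u) w v (- t v) w ⟩
        B u v + (- t v) * B u w + (- t u) * B w v + (- t u) * ((- t v) * Q w)
          ≈⟨ +-congʳ (+-congˡ (*-congˡ (B-sym w v))) ⟩
        B u v + (- t v) * B u w + (- t u) * B v w + (- t u) * ((- t v) * Q w)
          ≈⟨ solve 5 (λ b p r c q →
               b :+ (:- (con (+ 2) :* (c :* r))) :* p :+ (:- (con (+ 2) :* (c :* p))) :* r
                 :+ (:- (con (+ 2) :* (c :* p))) :* ((:- (con (+ 2) :* (c :* r))) :* q)
               := b :+ (con (+ 4) :* c :* p :* r) :* (c :* q :+ :- con (+ 1)))
               refl (B u v) (B u w) (B v w) Qw⁻¹ (Q w) ⟩
        B u v + (4# * Qw⁻¹ * B u w * B v w) * (Qw⁻¹ * Q w - 1#)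
          ≈⟨ +-congˡ (*-congˡ (trans (+-congʳ Qw⁻¹Qw≈1) (-‿inverseʳ 1#))) ⟩
        B u v + (4# * Qw⁻¹ * B u w * B v w) * 0#
          ≈⟨ trans (+-congˡ (zeroʳ _)) (+-identityʳ _) ⟩
        B u v ∎
        where
        4# : Carrier
        4# = ⟦ + 4 ⟧

      t-s : ∀ u → t (s u) ≈ - t u
      t-s u = trans (t-+ u _) (trans (+-congˡ (trans (t-· _ w) (*-congˡ t-w)))
        (solve 1 (λ p → p :+ (:- p) :* con (+ 2) := :- p) refl (t u)))

      s-involutive : ∀ u → s (s u) ≈ᵥ u
      s-involutive u i = trans (+-congˡ (*-congʳ (-‿cong (t-s u))))
        (solve 3 (λ a p z → (a :+ (:- p) :* z) :+ (:- (:- p)) :* z := a) refl (u i) (t u) (w i))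

      s-fixes : ∀ v → B v w ≈ 0# → s v ≈ᵥ v
      s-fixes v v⊥w i = trans (+-congˡ (*-congʳ (-‿cong t≈0)))
        (solve 2 (λ a z → a :+ (:- con (+ 0)) :* z := a) refl (v i) (w i))
        where
        t≈0 : t v ≈ 0#
        t≈0 = trans (*-congˡ (trans (*-congˡ v⊥w) (zeroʳ _))) (zeroʳ _)

      s-negates : s w ≈ᵥ ((- 1#) ·ᵥ w)
      s-negates i = trans (+-congˡ (*-congʳ (-‿cong t-w)))
        (solve 1 (λ z → z :+ (:- con (+ 2)) :* z := (:- con (+ 1)) :* z) refl (w i))

      s-hits : ∀ a → 2# * B a w ≈ Q w → s a ≈ᵥ (a +ᵥ ((- 1#) ·ᵥ w))
      s-hits a 2Baw≈Qw i = +-congˡ (*-congʳ (-‿cong t≈1))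
        where
        t≈1 : t a ≈ 1#
        t≈1 = trans (solve 2 (λ c p → con (+ 2) :* (c :* p) := c :* (con (+ 2) :* p)) refl Qw⁻¹ (B a w))
                    (trans (*-congˡ 2Baw≈Qw) Qw⁻¹Qw≈1)

      reflection : Isometry
      reflection = record
        { to = s ; from = s ; to-from = s-involutive ; from-to = s-involutive
        ; to-linear = s-linear ; from-linear = s-linear ; preserves = s-preserves }

    -- For a sign σ (σ² = 1) the vector a + σb satisfies
    --   Q(a + σb) = 2 B(a, a + σb)   and   B(a, a + σb) = 1 + σ B(a,b),
    -- which makes the reflection in a + σb send a to -σb.
    module UnitPair (a b : Vec n) (Qa≈1 : Q a ≈ 1#) (Qb≈1 : Q b ≈ 1#) where
      _⊕_ : Vec n → Carrier → Vec n
      a ⊕ σ = a +ᵥ (σ ·ᵥ b)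

      B-a⊕ : ∀ σ → B a (a ⊕ σ) ≈ 1# + σ * B a b
      B-a⊕ σ = trans (B-combʳ a a σ b) (+-congʳ Qa≈1)

      Q-a⊕ : ∀ σ → σ * σ ≈ 1# → Q (a ⊕ σ) ≈ 2# * B a (a ⊕ σ)
      Q-a⊕ σ σ²≈1 = begin
        Q (a ⊕ σ)                                          ≈⟨ B-comb a σ b a σ b ⟩
        B a a + σ * B a b + σ * B b a + σ * (σ * B b b)    ≈⟨ +-cong (+-cong (+-congʳ Qa≈1) (*-congˡ (B-sym b a))) σ²Qb≈1 ⟩
        1# + σ * B a b + σ * B a b + 1#                    ≈⟨ solve 2 (λ σ x → con (+ 1) :+ σ :* x :+ σ :* x :+ con (+ 1) := con (+ 2) :* (con (+ 1) :+ σ :* x)) refl σ (B a b) ⟩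
        2# * (1# + σ * B a b)                              ≈⟨ *-congˡ (B-a⊕ σ) ⟨
        2# * B a (a ⊕ σ)                                   ∎
        where
        σ²Qb≈1 : σ * (σ * B b b) ≈ 1#
        σ²Qb≈1 = trans (*-congˡ (trans (*-congˡ Qb≈1) (*-identityʳ σ))) σ²≈1

      ⊥-a⊕ : ∀ σ v → B v a ≈ 0# → B v b ≈ 0# → B v (a ⊕ σ) ≈ 0#
      ⊥-a⊕ σ v v⊥a v⊥b = trans (B-combʳ v a σ b)
        (trans (+-cong v⊥a (trans (*-congˡ v⊥b) (zeroʳ σ))) (+-identityʳ 0#))

      parallelogram : Q (a ⊕ 1#) + Q (a ⊕ (- 1#)) ≈ 2# * 2#
      parallelogram = begin
        Q (a ⊕ 1#) + Q (a ⊕ (- 1#))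
          ≈⟨ +-cong (Q-a⊕ 1# (*-identityˡ 1#)) (Q-a⊕ (- 1#) [-1]²≈1) ⟩
        2# * B a (a ⊕ 1#) + 2# * B a (a ⊕ (- 1#))
          ≈⟨ +-cong (*-congˡ (B-a⊕ 1#)) (*-congˡ (B-a⊕ (- 1#))) ⟩
        2# * (1# + 1# * B a b) + 2# * (1# + (- 1#) * B a b)
          ≈⟨ solve 1 (λ x → con (+ 2) :* (con (+ 1) :+ con (+ 1) :* x) :+ con (+ 2) :* (con (+ 1) :+ (:- con (+ 1)) :* x)
                            := con (+ 2) :* con (+ 2)) refl (B a b) ⟩
        2# * 2# ∎

      reflect-a : ∀ σ (≉0 : ¬ (Q (a ⊕ σ) ≈ 0#)) → σ * σ ≈ 1# → Reflection.s (a ⊕ σ) ≉0 a ≈ᵥ ((- σ) ·ᵥ b)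
      reflect-a σ ≉0 σ²≈1 = ≈ᵥ-trans (Reflection.s-hits (a ⊕ σ) ≉0 a (sym (Q-a⊕ σ σ²≈1)))
        (λ i → solve 3 (λ a σ b → a :+ (:- con (+ 1)) :* (a :+ σ :* b) := (:- σ) :* b) refl (a i) σ (b i))

      -- a and b are exchanged by an isometry fixing every vector orthogonal to
      -- both: the reflection in a - b if Q(a - b) ≠ 0, and otherwise (then
      -- Q(a + b) = 4 ≠ 0) the reflection in a + b followed by that in b
      exchange : Σ Isometry λ τ → (to τ a ≈ᵥ b) × (∀ v → B v a ≈ 0# → B v b ≈ 0# → to τ v ≈ᵥ v)
      exchange with Q (a ⊕ (- 1#)) ≟ 0#
      ... | no Qa-b≉0 = Reflection.reflection (a ⊕ (- 1#)) Qa-b≉0 , hits , fixes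
        where
        module Sa-b = Reflection (a ⊕ (- 1#)) Qa-b≉0
        hits : Sa-b.s a ≈ᵥ b
        hits = ≈ᵥ-trans (reflect-a (- 1#) Qa-b≉0 [-1]²≈1)
          (λ i → solve 1 (λ b → (:- (:- con (+ 1))) :* b := b) refl (b i))
        fixes : ∀ v → B v a ≈ 0# → B v b ≈ 0# → Sa-b.s v ≈ᵥ v
        fixes v v⊥a v⊥b = Sa-b.s-fixes v (⊥-a⊕ (- 1#) v v⊥a v⊥b)
      ... | yes Qa-b≈0 = Reflection.reflection b Qb≉0 ∘ᵢ Reflection.reflection (a ⊕ 1#) Qa+b≉0 , hits , fixes
        where
        Qb≉0 : ¬ (Q b ≈ 0#)
        Qb≉0 Qb≈0 = 1≉0 (trans (sym Qb≈1) Qb≈0)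
        Qa+b≉0 : ¬ (Q (a ⊕ 1#) ≈ 0#)
        Qa+b≉0 Qa+b≈0 = product-nonzero 2≉0 2≉0
          (trans (sym parallelogram) (trans (+-cong Qa+b≈0 Qa-b≈0) (+-identityʳ 0#)))
        module Sb = Reflection b Qb≉0
        module Sa+b = Reflection (a ⊕ 1#) Qa+b≉0
        hits : Sb.s (Sa+b.s a) ≈ᵥ b
        hits = ≈ᵥ-trans (IsLinear.cong Sb.s-linear (reflect-a 1# Qa+b≉0 (*-identityˡ 1#)))
          (≈ᵥ-trans (IsLinear.scale Sb.s-linear (- 1#) b)
          (λ i → trans (*-congˡ (Sb.s-negates i)) (solve 1 (λ b → (:- con (+ 1)) :* ((:- con (+ 1)) :* b) := b) refl (b i))))
        fixes : ∀ v → B v a ≈ 0# → B v b ≈ 0# → Sb.s (Sa+b.s v) ≈ᵥ v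
        fixes v v⊥a v⊥b = ≈ᵥ-trans (IsLinear.cong Sb.s-linear (Sa+b.s-fixes v (⊥-a⊕ 1# v v⊥a v⊥b))) (Sb.s-fixes v v⊥b)

    Orthonormal : ∀ {m} → (Fin m → Vec n) → Set ℓ
    Orthonormal u = ∀ i j → B (u i) (u j) ≈ δ i j

    -- By induction, the tails are matched
    -- by σ; then the exchange of σ(u₀) and u'₀ fixes the (orthogonal) tail.
    witt : ∀ m (u u' : Fin m → Vec n) → Orthonormal u → Orthonormal u' →
           Σ Isometry λ σ → ∀ i → to σ (u i) ≈ᵥ u' i
    witt zero    u u' _ _ = identity , λ ()
    witt (suc m) u u' on on' = τ ∘ᵢ σ , matches
      where
      tail : Σ Isometry λ σ → ∀ i → to σ (u (suc i)) ≈ᵥ u' (suc i)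
      tail = witt m (λ i → u (suc i)) (λ i → u' (suc i))
                    (λ i j → on (suc i) (suc j)) (λ i j → on' (suc i) (suc j))
      σ : Isometry
      σ = proj₁ tail
      σ-matches : ∀ i → to σ (u (suc i)) ≈ᵥ u' (suc i)
      σ-matches = proj₂ tail
      a : Vec n
      a = to σ (u zero)
      exchanged : Σ Isometry λ τ → (to τ a ≈ᵥ u' zero) ×
                    (∀ v → B v a ≈ 0# → B v (u' zero) ≈ 0# → to τ v ≈ᵥ v)
      exchanged = UnitPair.exchange a (u' zero) (trans (preserves σ _ _) (on zero zero)) (on' zero zero)
      τ : Isometry
      τ = proj₁ exchanged
      matches : ∀ i → to τ (to σ (u i)) ≈ᵥ u' i
      matches zero    = proj₁ (proj₂ exchanged)
      matches (suc i) = ≈ᵥ-trans (IsLinear.cong (to-linear τ) (σ-matches i))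
                          (proj₂ (proj₂ exchanged) (u' (suc i)) u'ᵢ⊥a (on' (suc i) zero))
        where
        u'ᵢ⊥a : B (u' (suc i)) a ≈ 0#
        u'ᵢ⊥a = trans (B-cong (≈ᵥ-sym (σ-matches i)) ≈ᵥ-refl) (trans (preserves σ _ _) (on (suc i) zero))

    _++ᶠ_ : ∀ {m₁ m₂} → (Fin m₁ → Vec n) → (Fin m₂ → Vec n) → Fin (m₁ ℕ.+ m₂) → Vec n
    _++ᶠ_ {m₁} u u' i = [ u , u' ]′ (splitAt m₁ i)

    ++ᶠ-↑ˡ : ∀ {m₁ m₂} (u : Fin m₁ → Vec n) (u' : Fin m₂ → Vec n) i → (u ++ᶠ u') (i ↑ˡ m₂) ≡ u i
    ++ᶠ-↑ˡ {m₁} {m₂} u u' i = ≡.cong [ u , u' ]′ (Finₚ.splitAt-↑ˡ m₁ i m₂)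

    ++ᶠ-↑ʳ : ∀ {m₁ m₂} (u : Fin m₁ → Vec n) (u' : Fin m₂ → Vec n) j → (u ++ᶠ u') (m₁ ↑ʳ j) ≡ u' j
    ++ᶠ-↑ʳ {m₁} {m₂} u u' j = ≡.cong [ u , u' ]′ (Finₚ.splitAt-↑ʳ m₁ m₂ j)

    ↑-view : ∀ m₁ {m₂} (i : Fin (m₁ ℕ.+ m₂)) →
             (Σ (Fin m₁) λ i' → i' ↑ˡ m₂ ≡ i) ⊎ (Σ (Fin m₂) λ j' → m₁ ↑ʳ j' ≡ i)
    ↑-view m₁ i with splitAt m₁ i in eq
    ... | inj₁ i' = inj₁ (i' , Finₚ.splitAt⁻¹-↑ˡ eq)
    ... | inj₂ j' = inj₂ (j' , Finₚ.splitAt⁻¹-↑ʳ eq)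

    ++ᶠ-orthonormal : ∀ {m₁ m₂} (u : Fin m₁ → Vec n) (u' : Fin m₂ → Vec n) →
                      Orthonormal u → Orthonormal u' → (∀ i j → B (u i) (u' j) ≈ 0#) →
                      Orthonormal (u ++ᶠ u')
    ++ᶠ-orthonormal {m₁} {m₂} u u' on on' u⊥u' i j with ↑-view m₁ i | ↑-view m₁ j
    ... | inj₁ (i' , ≡.refl) | inj₁ (j' , ≡.refl) =
      trans (B-cong (≡⇒≈ᵥ (++ᶠ-↑ˡ u u' i')) (≡⇒≈ᵥ (++ᶠ-↑ˡ u u' j')))
            (trans (on i' j') (reflexive (≡.sym (δ-↑ˡ↑ˡ m₂ i' j'))))
    ... | inj₂ (i' , ≡.refl) | inj₂ (j' , ≡.refl) =
      trans (B-cong (≡⇒≈ᵥ (++ᶠ-↑ʳ u u' i')) (≡⇒≈ᵥ (++ᶠ-↑ʳ u u' j')))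
            (trans (on' i' j') (reflexive (≡.sym (δ-↑ʳ↑ʳ m₁ i' j'))))
    ... | inj₁ (i' , ≡.refl) | inj₂ (j' , ≡.refl) =
      trans (B-cong (≡⇒≈ᵥ (++ᶠ-↑ˡ u u' i')) (≡⇒≈ᵥ (++ᶠ-↑ʳ u u' j')))
            (trans (u⊥u' i' j') (reflexive (≡.sym (δ-↑ˡ↑ʳ m₂ i' j'))))
    ... | inj₂ (i' , ≡.refl) | inj₁ (j' , ≡.refl) =
      trans (B-cong (≡⇒≈ᵥ (++ᶠ-↑ʳ u u' i')) (≡⇒≈ᵥ (++ᶠ-↑ˡ u u' j')))
            (trans (B-sym _ _) (trans (u⊥u' j' i')
              (reflexive (≡.sym (≡.trans (δ-sym (m₁ ↑ʳ i') (j' ↑ˡ m₂)) (δ-↑ˡ↑ʳ m₂ j' i'))))))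

  module Transitivity (n k : ℕ) (lam : Carrier) where
    open Isometries (diagonal-isSymBilinear (weight n lam))
    open Isometry
    open QuadraticSpace.Γ F n k lam
    open DotSubspace using (W; subspace)

    W-resp : ∀ (x : V) {u v} → u ≈ᵥ v → W x u → W x v
    W-resp x = IsSubspace.resp (subspace x)

    module _ (x : V) where
      open IsometricToDot (DotSubspace.iso x)
      φ⟨_⟩ : Vec k → Vec n
      φ⟨_⟩ = φ
      φ-linear : IsLinear φ
      φ-linear = linear
      φ-into : ∀ c → W x (φ c)
      φ-into = into
      φ-injective : ∀ c d → φ c ≈ᵥ φ d → c ≈ᵥ d
      φ-injective = injective
      φ-onto : ∀ v → W x v → Σ (Vec k) λ c → φ c ≈ᵥ v
      φ-onto = onto
      φ-isometry : ∀ c → lamQ n lam (φ c) ≈ dotQ k c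
      φ-isometry = isometry

    image : Isometry → V → V
    image σ x = record
      { W        = λ v → W x (from σ v)
      ; subspace = record
        { resp  = λ u≈v → W-resp x (IsLinear.cong (from-linear σ) u≈v)
        ; zero∈ = W-resp x (≈ᵥ-sym (linear-0 (from-linear σ))) (IsSubspace.zero∈ (subspace x))
        ; +∈    = λ u∈ v∈ → W-resp x (≈ᵥ-sym (IsLinear.add (from-linear σ) _ _)) (IsSubspace.+∈ (subspace x) u∈ v∈)
        ; ·∈    = λ a v∈ → W-resp x (≈ᵥ-sym (IsLinear.scale (from-linear σ) a _)) (IsSubspace.·∈ (subspace x) a v∈) }
      ; iso = record
        { φ         = λ c → to σ (φ⟨ x ⟩ c)
        ; linear    = ∘-linear (φ-linear x) (to-linear σ)
        ; into      = λ c → W-resp x (≈ᵥ-sym (from-to σ _)) (φ-into x c)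
        ; injective = λ c d σφc≈σφd → φ-injective x c d
            (≈ᵥ-trans (≈ᵥ-sym (from-to σ _)) (≈ᵥ-trans (IsLinear.cong (from-linear σ) σφc≈σφd) (from-to σ _)))
        ; onto      = λ v v∈ → let (c , φc≈) = φ-onto x (from σ v) v∈ in
            c , ≈ᵥ-trans (IsLinear.cong (to-linear σ) φc≈) (to-from σ v)
        ; isometry  = λ c → trans (preserves σ _ _) (φ-isometry x c) } }

    automorphism : Isometry → Automorphism
    automorphism σ = record
      { to        = image σ
      ; from      = image (inverse-isometry σ)
      ; to-cong   = λ x≈y v → x≈y (from σ v)
      ; from-cong = λ x≈y v → x≈y (to σ v)
      ; to-from   = λ x v → W-resp x (to-from σ v) , W-resp x (≈ᵥ-sym (to-from σ v))
      ; from-to   = λ x v → W-resp x (from-to σ v) , W-resp x (≈ᵥ-sym (from-to σ v))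
      ; adj       = λ x y →
          (λ x~y u v u∈ v∈ → trans (sym (from-preserves σ u v)) (x~y _ _ u∈ v∈)) ,
          (λ σx~σy u v u∈ v∈ → trans (sym (preserves σ u v))
             (σx~σy _ _ (W-resp x (≈ᵥ-sym (from-to σ u)) u∈) (W-resp y (≈ᵥ-sym (from-to σ v)) v∈))) }

    image-≈V : ∀ σ (x y : V) → (∀ c → to σ (φ⟨ x ⟩ c) ≈ᵥ φ⟨ y ⟩ c) → image σ x ≈V y
    image-≈V σ x y σφx≈φy v =
      (λ v∈ → let (c , φc≈) = φ-onto x _ v∈ in
        W-resp y (≈ᵥ-trans (≈ᵥ-sym (σφx≈φy c)) (≈ᵥ-trans (IsLinear.cong (to-linear σ) φc≈) (to-from σ v))) (φ-into y c)) ,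
      (λ v∈ → let (c , φc≈) = φ-onto y _ v∈ in
        W-resp x (≈ᵥ-trans (≈ᵥ-sym (from-to σ _)) (IsLinear.cong (from-linear σ) (≈ᵥ-trans (σφx≈φy c) φc≈))) (φ-into x c))

    frame : V → Fin k → Vec n
    frame x i = φ⟨ x ⟩ (δ i)

    frame-orthonormal : ∀ (x : V) → Orthonormal (frame x)
    frame-orthonormal x i j =
      trans (polarisation-preserves (diagonal-isSymBilinear (λ _ → 1#)) (diagonal-isSymBilinear (weight n lam))
               (φ-linear x) φ-isometric (δ i) (δ j))
            (dot-δ i j)
      where
      φ-isometric : ∀ c → lamQ n lam (φ⟨ x ⟩ c) ≈ diagonal (λ _ → 1#) c c
      φ-isometric c = trans (φ-isometry x c) (sum-cong k (λ l → sym (*-identityˡ _)))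

    frame-match : ∀ σ (x y : V) → (∀ i → to σ (frame x i) ≈ᵥ frame y i) → image σ x ≈V y
    frame-match σ x y matched =
      image-≈V σ x y (linear-extensionality (∘-linear (φ-linear x) (to-linear σ)) (φ-linear y) matched)

    vertex-transitive : VertexTransitive
    vertex-transitive x y = automorphism (proj₁ frames) , frame-match (proj₁ frames) x y (proj₂ frames)
      where
      frames : Σ Isometry λ σ → ∀ i → to σ (frame x i) ≈ᵥ frame y i
      frames = witt k (frame x) (frame y) (frame-orthonormal x) (frame-orthonormal y)

    edge-frame : V → V → Fin (k ℕ.+ k) → Vec n
    edge-frame x y = frame x ++ᶠ frame y

    edge-frame-orthonormal : ∀ (x y : V) → Adj x y → Orthonormal (edge-frame x y)
    edge-frame-orthonormal x y x~y = ++ᶠ-orthonormal (frame x) (frame y)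
      (frame-orthonormal x) (frame-orthonormal y)
      (λ i j → x~y _ _ (φ-into x (δ i)) (φ-into y (δ j)))

    arc-transitive : ArcTransitive
    arc-transitive x y x' y' x~y x'~y' =
      automorphism σ , frame-match σ x x' matchedˡ , frame-match σ y y' matchedʳ
      where
      edges : Σ Isometry λ σ → ∀ i → to σ (edge-frame x y i) ≈ᵥ edge-frame x' y' i
      edges = witt (k ℕ.+ k) (edge-frame x y) (edge-frame x' y')
                   (edge-frame-orthonormal x y x~y) (edge-frame-orthonormal x' y' x'~y')
      σ : Isometry
      σ = proj₁ edges
      matched : ∀ i → to σ (edge-frame x y i) ≈ᵥ edge-frame x' y' i
      matched = proj₂ edges
      matchedˡ : ∀ i → to σ (frame x i) ≈ᵥ frame x' i
      matchedˡ i = ≈ᵥ-trans (IsLinear.cong (to-linear σ) (≡⇒≈ᵥ (≡.sym (++ᶠ-↑ˡ (frame x) (frame y) i))))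
                  (≈ᵥ-trans (matched (i ↑ˡ k)) (≡⇒≈ᵥ (++ᶠ-↑ˡ (frame x') (frame y') i)))
      matchedʳ : ∀ j → to σ (frame y j) ≈ᵥ frame y' j
      matchedʳ j = ≈ᵥ-trans (IsLinear.cong (to-linear σ) (≡⇒≈ᵥ (≡.sym (++ᶠ-↑ʳ (frame x) (frame y) j))))
                  (≈ᵥ-trans (matched (k ↑ʳ j)) (≡⇒≈ᵥ (++ᶠ-↑ʳ (frame x') (frame y') j)))

injective-misses-nothing : ∀ m (f : Fin m → Fin m) → Injective _≡_ _≡_ f →
                           ∀ t → ¬ (∀ i → f i ≢ t)
injective-misses-nothing zero    f f-injective () _
injective-misses-nothing (suc m) f f-injective t misses =
  ℕₚ.<-irrefl ≡.refl (Finₚ.injective⇒≤ g-injective)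
  where
  -- squeezing out the missed value t gives an injection Fin (suc m) → Fin m
  g : Fin (suc m) → Fin m
  g i = Fin.punchOut (≢-sym (misses i))
  g-injective : Injective _≡_ _≡_ g
  g-injective gi≡gj = f-injective (Finₚ.punchOut-injective (≢-sym (misses _)) (≢-sym (misses _)) gi≡gj)

module FiniteField {c ℓ} (F : Field c ℓ) (q : ℕ) (card : HasCard F q) where
  open Field F
  open FieldArithmetic F
  open Inverse card using (to; from; from-cong; inverseˡ; inverseʳ)

  from-injective : ∀ {x y} → from x ≡ from y → x ≈ y
  from-injective {x} {y} fx≡fy =
    trans (sym (inverseˡ ≡.refl)) (trans (reflexive (≡.cong to fx≡fy)) (inverseˡ ≡.refl))

  _≟_ : ∀ x y → Dec (x ≈ y)
  x ≟ y with from x Finₚ.≟ from y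
  ... | yes fx≡fy = yes (from-injective fx≡fy)
  ... | no  fx≢fy = no (λ x≈y → fx≢fy (from-cong x≈y))

  -- If 2 = 0 then squaring is injective, hence (F being finite) surjective;
  -- so the existence of a nonsquare forces 2 ≠ 0.
  2≉0 : ∀ lam → (∀ a → ¬ (a * a ≈ lam)) → ¬ (2# ≈ 0#)
  2≉0 lam nonsquare 2≈0 = injective-misses-nothing q square square-inj (from lam) misses
    where
    square : Fin q → Fin q
    square i = from (to i * to i)
    square-inj : Injective _≡_ _≡_ square
    square-inj {i} {j} sqi≡sqj = begin
      i                 ≡⟨ inverseʳ refl ⟨
      from (to i)       ≡⟨ from-cong (square-injective _≟_ 2≈0 (from-injective sqi≡sqj)) ⟩
      from (to j)       ≡⟨ inverseʳ refl ⟩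
      j                 ∎
      where open ≡.≡-Reasoning
    misses : ∀ i → square i ≢ from lam
    misses i sqi≡lam = nonsquare (to i) (from-injective sqi≡lam)

-- ℕ multiplication is needed only in the statement (inside the modules above,
-- _*_ is field multiplication).
open import Data.Nat using (_*_)

-- Over a finite field with a nonsquare, Geometry applies.
mainTheorem3 : ∀ {c ℓ} (F : Field c ℓ) (q : ℕ) → OddPrimePower q → HasCard F q →
    (lam : Field.Carrier F) → (∀ a → ¬ (Field._≈_ F (Field._*_ F a a) lam)) →
    (n k : ℕ) → 0 < n → 0 < k → 2 * k < n →
    QuadraticSpace.Γ.VertexTransitive F n k lam × QuadraticSpace.Γ.ArcTransitive F n k lam
mainTheorem3 F q _ card lam nonsquare n k _ _ _ = vertex-transitive , arc-transitive
  where
  open FiniteField F q card using (_≟_; 2≉0)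
  open Geometry F _≟_ (2≉0 lam nonsquare)
  open Transitivity n k lam
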